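{- Let $s=q_1,\ldots,q_n$ be a non-leaping sequence, let $W_1,\ldots,W_n$ be any neighborhood sequence of $s$ (with associated $a_k$), let $G$ be the corresponding graph and $\mathcal{D}$ its distance matrix, and let $E$ be the reducing matrix of this neighborhood sequence. Then $E^\top\mathcal{D}E$ equals the weighted adjacency matrix $A$ of the reduced graph of $s$. In particular, $E^\top \mathcal{D} E$ does not depend on the choice of the neighborhood sequence.
   Context: A sequence of integers $q_1,\ldots,q_n$ ($n\ge 2$) is non-leaping if $q_1=0$, $q_2=1$, and $2\le q_k\le q_{k-1}+1$ for $k=3,\ldots,n$. Set $b_k=k-q_k+1$ for $k\ge 3$, and $a_2=1$, $b_2=2$. A neighborhood sequence of $s$ is a sequence of sets $W_1=\varnothing$, $W_2=\{1\}$, and for $k\ge3$, $W_k=\{a_k\}\cup\{b_k,b_k+1,\ldots,k-1\}$ where $a_k\in W_{k-1}$ and $a_k<b_k$ (so $|W_k|=q_k$). The corresponding graph has vertex set $\{1,\ldots,n\}$ and, for each $k$, vertex $k$ is joined to every vertex of $W_k$ (these are all the edges). The distance matrix is $\mathcal{D}=[\operatorname{dist}_G(i,j)]$. The reducing matrix $E$ is the $n\times n$ matrix whose $k$-th column is ${\bf e}_k$ for $k\in\{1,2\}$ and ${\bf e}_k-{\bf e}_{a_k}-{\bf e}_{k-1}+{\bf e}_{a_{k-1}}$ for $k\ge3$, where ${\bf e}_i$ are standard basis vectors. The weighted adjacency matrix $A=[A_{i,j}]$ of the reduced graph of $s$ is the symmetric $n\times n$ matrix with $A_{1,1}=A_{2,2}=0$,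 $A_{k,k}=-2$ for $k\ge3$, $A_{1,2}=A_{2,1}=1$, and for $k\ge 3$ and $i<k$, $A_{i,k}=A_{k,i}=[i=b_{k-1}]-[i=b_k]+[i=k-1]$, where $[P]$ is $1$ if $P$ holds and $0$ otherwise. -}

module Defs where

open import Data.Nat using (ℕ; zero; suc; _+_; _∸_; _≤_; _<_; _≟_; _<ᵇ_)
open import Data.Bool using (Bool; true; false; if_then_else_)
open import Data.Integer as ℤ using (ℤ; +_; -_)
open import Data.Product using (_×_; Σ; _,_)
open import Data.Sum using (_⊎_)
open import Relation.Nullary.Decidable using (⌊_⌋)
open import Relation.Binary.PropositionalEquality using (_≡_)

-- All sequences are indexed 1..n by natural numbers (values outside are irrelevant).

[_≐_] : ℕ → ℕ → ℤ
[ i ≐ j ] = if ⌊ i ≟ j ⌋ then + 1 else + 0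

NonLeaping : ℕ → (ℕ → ℕ) → Set
NonLeaping n q = q 1 ≡ 0 × q 2 ≡ 1 ×
  (∀ k → 3 ≤ k → k ≤ n → 2 ≤ q k × q k ≤ q (k ∸ 1) + 1)

bseq : (ℕ → ℕ) → ℕ → ℕ
bseq q k = if k <ᵇ 3 then 2 else (k + 1) ∸ q k

-- membership i ∈ W_k, for the neighborhood sequence determined by a
-- (W_1 = ∅, W_2 = {1}, W_k = {a_k} ∪ {b_k, …, k-1} for k ≥ 3)
InW : (ℕ → ℕ) → (ℕ → ℕ) → ℕ → ℕ → Set
InW q a k i = (k ≡ 2 × i ≡ 1) ⊎ (3 ≤ k × (i ≡ a k ⊎ (bseq q k ≤ i × i < k)))

NeighborhoodSeq : ℕ → (ℕ → ℕ) → (ℕ → ℕ) → Set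
NeighborhoodSeq n q a = a 2 ≡ 1 ×
  (∀ k → 3 ≤ k → k ≤ n → InW q a (k ∸ 1) (a k) × a k < bseq q k)

Adj : ℕ → (ℕ → ℕ) → (ℕ → ℕ) → ℕ → ℕ → Set
Adj n q a i j = (1 ≤ i × i ≤ n) × (1 ≤ j × j ≤ n) × (InW q a j i ⊎ InW q a i j)

data Walk (n : ℕ) (q a : ℕ → ℕ) : ℕ → ℕ → ℕ → Set where
  nil  : ∀ {i} → 1 ≤ i → i ≤ n → Walk n q a i i 0
  cons : ∀ {i j k l} → Adj n q a i j → Walk n q a j k l → Walk n q a i k (suc l)

IsDist : ℕ → (ℕ → ℕ) → (ℕ → ℕ) → ℕ → ℕ → ℕ → Set
IsDist n q a i j d = Walk n q a i j d × (∀ m → Walk n q a i j m → d ≤ m)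

IsDistMatrix : ℕ → (ℕ → ℕ) → (ℕ → ℕ) → (ℕ → ℕ → ℕ) → Set
IsDistMatrix n q a D = ∀ i j → 1 ≤ i → i ≤ n → 1 ≤ j → j ≤ n → IsDist n q a i j (D i j)

sumTo : ℕ → (ℕ → ℤ) → ℤ
sumTo zero    f = + 0
sumTo (suc m) f = sumTo m f ℤ.+ f (suc m)

Emat : (ℕ → ℕ) → ℕ → ℕ → ℤ
Emat a r k = if k <ᵇ 3 then [ r ≐ k ]
  else ((([ r ≐ k ] ℤ.- [ r ≐ a k ]) ℤ.- [ r ≐ k ∸ 1 ]) ℤ.+ [ r ≐ a (k ∸ 1) ])

EtDE : ℕ → (ℕ → ℕ) → (ℕ → ℕ → ℕ) → ℕ → ℕ → ℤ
EtDE n a D i j = sumTo n (λ r → sumTo n (λ s →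
  (Emat a r i ℤ.* (+ D r s)) ℤ.* Emat a s j))

Aupper : (ℕ → ℕ) → ℕ → ℕ → ℤ
Aupper q i k = if k <ᵇ 3 then + 1   -- (i,k) = (1,2)
  else (([ i ≐ bseq q (k ∸ 1) ] ℤ.- [ i ≐ bseq q k ]) ℤ.+ [ i ≐ k ∸ 1 ])

Amat : (ℕ → ℕ) → ℕ → ℕ → ℤ
Amat q i j = if ⌊ i ≟ j ⌋ then (if j <ᵇ 3 then + 0 else - (+ 2))
  else (if i <ᵇ j then Aupper q i j else Aupper q j i)

-- The metric
-- input is that the vertices b_k, …, k−1 are adjacent both to k and to a_k, while every walk from
-- k into {1, …, b_k − 1} must pass through a_k or a neighbour of a_k (the neighbourhoods W_w are
-- cliques containing a_k for b_k ≤ w < k); hence dist(k, r) = 1 + dist(a_k, r) for r < b_k, and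
-- dist(r, k) − dist(r, a_k) = [r < b_k] − [r = k] for r ≤ k.  Taking differences, the column
-- k+1 of D E has the entries ([r < b_{k+1}] − [r < b_k]) + [r = k] for r ≤ k, and applying E from
-- the left the brackets telescope to A.  On the diagonal one also needs
-- dist(a_{k+1}, a_k) + [a_{k+1} < b_k] = 1, since a_{k+1} ∈ W_k is a_k or a neighbour of it.

module Submission where

open import Data.Bool using (true; false; if_then_else_)
open import Data.Bool.Properties using (T-≡)
open import Data.Integer using (ℤ; +_; -_; _+_; _-_; _*_)
import Data.Integer.Properties as ℤ
open import Data.Integer.Tactic.RingSolver using (solve-∀)
open import Data.Nat as ℕ using (ℕ; zero; suc; _≤_; _<_; z≤n; s≤s; _∸_; _<ᵇ_; _≟_; _≤?_; _<?_)
import Data.Nat.Properties as ℕ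
open import Data.Nat.Properties using (≤-refl; ≤-trans; <-trans; <-≤-trans; ≤-<-trans; <⇒≤)
open import Data.Product using (_×_; _,_; proj₁; proj₂)
open import Data.Sum using (_⊎_; inj₁; inj₂)
open import Function using (_∘_)
open import Function.Bundles using (Equivalence)
open import Relation.Binary.Definitions using (tri<; tri≈; tri>)
open import Relation.Binary.PropositionalEquality
open import Relation.Nullary using (yes; no; contradiction)
open import Relation.Nullary.Decidable using (⌊_⌋)
open import Defs

<ᵇ-true : ∀ {m n} → m < n → (m <ᵇ n) ≡ true
<ᵇ-true m<n = Equivalence.to T-≡ (ℕ.<⇒<ᵇ m<n)

<ᵇ-false : ∀ {m n} → n ≤ m → (m <ᵇ n) ≡ false
<ᵇ-false {m} {n} n≤m with m <ᵇ n in eq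
... | false = refl
... | true  = contradiction (ℕ.<ᵇ⇒< m n (Equivalence.from T-≡ eq)) (ℕ.≤⇒≯ n≤m)

≟-true : ∀ {x y} → x ≡ y → ⌊ x ≟ y ⌋ ≡ true
≟-true {x} {y} x≡y with x ≟ y
... | yes _   = refl
... | no x≢y = contradiction x≡y x≢y

≟-false : ∀ {x y} → x ≢ y → ⌊ x ≟ y ⌋ ≡ false
≟-false {x} {y} x≢y with x ≟ y
... | yes x≡y = contradiction x≡y x≢y
... | no _    = refl

≐-≡ : ∀ {x y} → x ≡ y → [ x ≐ y ] ≡ + 1
≐-≡ x≡y rewrite ≟-true x≡y = refl

≐-≢ : ∀ {x y} → x ≢ y → [ x ≐ y ] ≡ + 0
≐-≢ x≢y rewrite ≟-false x≢y = refl

[_≺_] : ℕ → ℕ → ℤ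
[ i ≺ c ] = if i <ᵇ c then + 1 else + 0

≺-< : ∀ {i c} → i < c → [ i ≺ c ] ≡ + 1
≺-< i<c rewrite <ᵇ-true i<c = refl

≺-≥ : ∀ {i c} → c ≤ i → [ i ≺ c ] ≡ + 0
≺-≥ {i} {c} c≤i rewrite <ᵇ-false {i} {c} c≤i = refl

≺-≤ : ∀ {i c} → i ≤ c → [ i ≺ c ] ≡ + 1 - [ i ≐ c ]
≺-≤ {i} i≤c with ℕ.m≤n⇒m<n∨m≡n i≤c
... | inj₁ i<c  rewrite ≺-< i<c | ≐-≢ (ℕ.<⇒≢ i<c) = refl
... | inj₂ refl rewrite ≺-≥ (≤-refl {i}) | ≐-≡ (refl {x = i}) = refl

≺-suc : ∀ i c → [ suc i ≺ c ] - [ i ≺ c ] ≡ - [ suc i ≐ c ]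
≺-suc i c with ℕ.<-cmp (suc i) c
... | tri< 1+i<c _ _ rewrite ≺-< 1+i<c | ≺-< (<-trans (ℕ.n<1+n i) 1+i<c) | ≐-≢ (ℕ.<⇒≢ 1+i<c) = refl
... | tri≈ _ refl _ rewrite ≺-≥ (≤-refl {suc i}) | ≺-< (ℕ.n<1+n i) | ≐-≡ (refl {x = suc i}) = refl
... | tri> _ 1+i≢c c<1+i rewrite ≺-≥ (<⇒≤ c<1+i) | ≺-≥ (ℕ.≤-pred c<1+i) | ≐-≢ 1+i≢c = refl

sumTo-cong : ∀ m {f g : ℕ → ℤ} → (∀ s → f s ≡ g s) → sumTo m f ≡ sumTo m g
sumTo-cong zero    f≗g = refl
sumTo-cong (suc m) f≗g = cong₂ _+_ (sumTo-cong m f≗g) (f≗g (suc m))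

sumTo-+ : ∀ m (f g : ℕ → ℤ) → sumTo m (λ s → f s + g s) ≡ sumTo m f + sumTo m g
sumTo-+ zero    f g = refl
sumTo-+ (suc m) f g rewrite sumTo-+ m f g = interchange (sumTo m f) (sumTo m g) (f (suc m)) (g (suc m))
  where
  interchange : ∀ w x y z → (w + x) + (y + z) ≡ (w + y) + (x + z)
  interchange = solve-∀

sumTo-neg : ∀ m (f : ℕ → ℤ) → sumTo m (λ s → - f s) ≡ - sumTo m f
sumTo-neg zero    f = refl
sumTo-neg (suc m) f rewrite sumTo-neg m f = sym (ℤ.neg-distrib-+ (sumTo m f) (f (suc m)))

sumTo-difference : ∀ m (f g : ℕ → ℤ) → sumTo m (λ s → f s - g s) ≡ sumTo m f - sumTo m g
sumTo-difference m f g = trans (sumTo-+ m f (λ s → - g s)) (cong (λ z → sumTo m f + z) (sumTo-neg m g))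

sumTo-δ-beyond : ∀ m c (f : ℕ → ℤ) → m < c → sumTo m (λ s → f s * [ s ≐ c ]) ≡ + 0
sumTo-δ-beyond zero    c f m<c = refl
sumTo-δ-beyond (suc m) c f m<c
  rewrite sumTo-δ-beyond m c f (<-trans (ℕ.n<1+n m) m<c) | ≐-≢ (ℕ.<⇒≢ m<c)
  = trans (ℤ.+-identityˡ _) (ℤ.*-zeroʳ (f (suc m)))

sumTo-δ : ∀ m c (f : ℕ → ℤ) → 1 ≤ c → c ≤ m → sumTo m (λ s → f s * [ s ≐ c ]) ≡ f c
sumTo-δ zero    zero    f () _
sumTo-δ zero    (suc _) f _  ()
sumTo-δ (suc m) c f 1≤c c≤1+m with ℕ.m≤n⇒m<n∨m≡n c≤1+m
... | inj₂ refl rewrite sumTo-δ-beyond m (suc m) f (ℕ.n<1+n m) | ≐-≡ (refl {x = suc m})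
  = trans (ℤ.+-identityˡ _) (ℤ.*-identityʳ (f (suc m)))
... | inj₁ c<1+m rewrite sumTo-δ m c f 1≤c (ℕ.≤-pred c<1+m) | ≐-≢ (ℕ.<⇒≢ c<1+m ∘ sym)
  = trans (cong (λ z → f c + z) (ℤ.*-zeroʳ (f (suc m)))) (ℤ.+-identityʳ (f c))

rowE : (ℕ → ℕ) → (ℕ → ℤ) → ℕ → ℤ
rowE a f j = if j <ᵇ 3 then f j else ((f j - f (a j)) - f (j ∸ 1)) + f (a (j ∸ 1))

rowE-small : ∀ a f {j} → j < 3 → rowE a f j ≡ f j
rowE-small a f j<3 rewrite <ᵇ-true j<3 = refl

rowE-large : ∀ a f {j} → 3 ≤ j → rowE a f j ≡ ((f j - f (a j)) - f (j ∸ 1)) + f (a (j ∸ 1))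
rowE-large a f {j} 3≤j rewrite <ᵇ-false {j} {3} 3≤j = refl

rowE-scale : ∀ a c (f : ℕ → ℤ) j → rowE a (λ s → c * f s) j ≡ c * rowE a f j
rowE-scale a c f j with j <ᵇ 3
... | true  = refl
... | false = distrib c (f j) (f (a j)) (f (j ∸ 1)) (f (a (j ∸ 1)))
  where
  distrib : ∀ c x y z w → ((c * x - c * y) - c * z) + c * w ≡ c * (((x - y) - z) + w)
  distrib = solve-∀

rowE-swap : ∀ a (F : ℕ → ℕ → ℤ) i j →
  rowE a (λ r → rowE a (λ s → F r s) j) i ≡ rowE a (λ s → rowE a (λ r → F r s) i) j
rowE-swap a F i j with i <ᵇ 3 | j <ᵇ 3
... | true  | true  = refl
... | true  | false = refl
... | false | true  = refl
... | false | false = swap4×4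
  (F i j) (F i (a j)) (F i (j ∸ 1)) (F i (a (j ∸ 1)))
  (F (a i) j) (F (a i) (a j)) (F (a i) (j ∸ 1)) (F (a i) (a (j ∸ 1)))
  (F (i ∸ 1) j) (F (i ∸ 1) (a j)) (F (i ∸ 1) (j ∸ 1)) (F (i ∸ 1) (a (j ∸ 1)))
  (F (a (i ∸ 1)) j) (F (a (i ∸ 1)) (a j)) (F (a (i ∸ 1)) (j ∸ 1)) (F (a (i ∸ 1)) (a (j ∸ 1)))
  where
  swap4×4 : ∀ x₁ x₂ x₃ x₄ y₁ y₂ y₃ y₄ z₁ z₂ z₃ z₄ w₁ w₂ w₃ w₄ →
    ((((x₁ - x₂) - x₃) + x₄ - (((y₁ - y₂) - y₃) + y₄)) - (((z₁ - z₂) - z₃) + z₄)) + (((w₁ - w₂) - w₃) + w₄)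
    ≡ ((((x₁ - y₁) - z₁) + w₁ - (((x₂ - y₂) - z₂) + w₂)) - (((x₃ - y₃) - z₃) + w₃)) + (((x₄ - y₄) - z₄) + w₄)
  swap4×4 = solve-∀

InRange : ℕ → ℕ → Set
InRange n x = 1 ≤ x × x ≤ n

ColumnInRange : ℕ → (ℕ → ℕ) → ℕ → Set
ColumnInRange n a j = InRange n j × (3 ≤ j → InRange n (a j) × InRange n (j ∸ 1) × InRange n (a (j ∸ 1)))

rowE-cong : ∀ {n a j} {f g : ℕ → ℤ} → ColumnInRange n a j → (∀ s → InRange n s → f s ≡ g s) →
            rowE a f j ≡ rowE a g j
rowE-cong {a = a} {j} {f} {g} (j∈ , support) f≗g with 3 ≤? j
... | no 3≰j = trans (rowE-small a f j<3) (trans (f≗g j j∈) (sym (rowE-small a g j<3)))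
  where j<3 = ℕ.≰⇒> 3≰j
... | yes 3≤j with support 3≤j
...   | aj∈ , j-1∈ , aj-1∈ = trans (rowE-large a f 3≤j) (trans
  (cong₂ _+_ (cong₂ _-_ (cong₂ _-_ (f≗g _ j∈) (f≗g _ aj∈)) (f≗g _ j-1∈)) (f≗g _ aj-1∈))
  (sym (rowE-large a g 3≤j)))

sumTo-*-Emat : ∀ n a (f : ℕ → ℤ) {j} → ColumnInRange n a j → sumTo n (λ s → f s * Emat a s j) ≡ rowE a f j
sumTo-*-Emat n a f {j} ((1≤j , j≤n) , support) with 3 ≤? j
... | no 3≰j rewrite <ᵇ-true (ℕ.≰⇒> 3≰j) = sumTo-δ n j f 1≤j j≤n
... | yes 3≤j rewrite <ᵇ-false {j} {3} 3≤j with support 3≤j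
...   | (1≤aj , aj≤n) , (1≤j-1 , j-1≤n) , (1≤aj-1 , aj-1≤n) = begin
    sumTo n (λ s → f s * ((([ s ≐ j ] - [ s ≐ a j ]) - [ s ≐ j ∸ 1 ]) + [ s ≐ a (j ∸ 1) ]))
  ≡⟨ sumTo-cong n (λ s → distrib (f s) [ s ≐ j ] [ s ≐ a j ] [ s ≐ j ∸ 1 ] [ s ≐ a (j ∸ 1) ]) ⟩
    sumTo n (λ s → ((δ j s - δ (a j) s) - δ (j ∸ 1) s) + δ (a (j ∸ 1)) s)
  ≡⟨ sumTo-+ n _ _ ⟩
    sumTo n (λ s → (δ j s - δ (a j) s) - δ (j ∸ 1) s) + sumTo n (δ (a (j ∸ 1)))
  ≡⟨ cong (_+ sumTo n (δ (a (j ∸ 1))))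
          (trans (sumTo-difference n _ _) (cong (_- sumTo n (δ (j ∸ 1))) (sumTo-difference n _ _))) ⟩
    ((sumTo n (δ j) - sumTo n (δ (a j))) - sumTo n (δ (j ∸ 1))) + sumTo n (δ (a (j ∸ 1)))
  ≡⟨ cong₂ _+_ (cong₂ _-_ (cong₂ _-_ (sumTo-δ n _ f 1≤j j≤n) (sumTo-δ n _ f 1≤aj aj≤n)) (sumTo-δ n _ f 1≤j-1 j-1≤n))
               (sumTo-δ n _ f 1≤aj-1 aj-1≤n) ⟩
    ((f j - f (a j)) - f (j ∸ 1)) + f (a (j ∸ 1))
  ∎
  where
  open ≡-Reasoning
  δ : ℕ → ℕ → ℤ
  δ c s = f s * [ s ≐ c ]
  distrib : ∀ x y z u v → x * (((y - z) - u) + v) ≡ ((x * y - x * z) - x * u) + x * v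
  distrib = solve-∀

EtDE≡rowE² : ∀ n a D {i j} → ColumnInRange n a i → ColumnInRange n a j →
             EtDE n a D i j ≡ rowE a (λ r → rowE a (λ s → + D r s) j) i
EtDE≡rowE² n a D {i} {j} col-i col-j = begin
    sumTo n (λ r → sumTo n (λ s → (Emat a r i * + D r s) * Emat a s j))
  ≡⟨ sumTo-cong n (λ r → sumTo-*-Emat n a (λ s → Emat a r i * + D r s) col-j) ⟩
    sumTo n (λ r → rowE a (λ s → Emat a r i * + D r s) j)
  ≡⟨ sumTo-cong n (λ r → trans (rowE-scale a (Emat a r i) (λ s → + D r s) j) (ℤ.*-comm (Emat a r i) _)) ⟩
    sumTo n (λ r → rowE a (λ s → + D r s) j * Emat a r i)
  ≡⟨ sumTo-*-Emat n a (λ r → rowE a (λ s → + D r s) j) col-i ⟩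
    rowE a (λ r → rowE a (λ s → + D r s) j) i
  ∎
  where open ≡-Reasoning

Aupper-large : ∀ q i {k} → 3 ≤ k → Aupper q i k ≡ ([ i ≐ bseq q (k ∸ 1) ] - [ i ≐ bseq q k ]) + [ i ≐ k ∸ 1 ]
Aupper-large q i {k} 3≤k rewrite <ᵇ-false {k} {3} 3≤k = refl

Amat-< : ∀ q {i j} → i < j → Amat q i j ≡ Aupper q i j
Amat-< q i<j rewrite ≟-false (ℕ.<⇒≢ i<j) | <ᵇ-true i<j = refl

Amat-diag : ∀ q {i} → 3 ≤ i → Amat q i i ≡ - + 2
Amat-diag q {i} 3≤i rewrite ≟-true (refl {x = i}) | <ᵇ-false {i} {3} 3≤i = refl

Amat-sym : ∀ q i j → Amat q i j ≡ Amat q j i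
Amat-sym q i j with ℕ.<-cmp i j
... | tri≈ _ refl _ = refl
... | tri< i<j i≢j _ rewrite ≟-false i≢j | ≟-false (i≢j ∘ sym) | <ᵇ-true i<j | <ᵇ-false {j} {i} (<⇒≤ i<j) = refl
... | tri> _ i≢j j<i rewrite ≟-false i≢j | ≟-false (i≢j ∘ sym) | <ᵇ-true j<i | <ᵇ-false {i} {j} (<⇒≤ j<i) = refl

module Walks (n : ℕ) (q a : ℕ → ℕ) where

  Adj-sym : ∀ {x y} → Adj n q a x y → Adj n q a y x
  Adj-sym (x∈ , y∈ , inj₁ x∈Wy) = y∈ , x∈ , inj₂ x∈Wy
  Adj-sym (x∈ , y∈ , inj₂ y∈Wx) = y∈ , x∈ , inj₁ y∈Wx

  walk-snoc : ∀ {i j k l} → Walk n q a i j l → Adj n q a j k → Walk n q a i k (suc l)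
  walk-snoc (nil _ _)     j~k = cons j~k (nil (proj₁ (proj₁ (proj₂ j~k))) (proj₂ (proj₁ (proj₂ j~k))))
  walk-snoc (cons i~x xj) j~k = cons i~x (walk-snoc xj j~k)

  walk-reverse : ∀ {i j l} → Walk n q a i j l → Walk n q a j i l
  walk-reverse (nil 1≤i i≤n)  = nil 1≤i i≤n
  walk-reverse (cons i~x xj) = walk-snoc (walk-reverse xj) (Adj-sym i~x)

  walk₀⇒≡ : ∀ {i j} → Walk n q a i j 0 → i ≡ j
  walk₀⇒≡ (nil _ _) = refl

module Neighbourhood {n : ℕ} {q a : ℕ → ℕ} (nonLeaping : NonLeaping n q) (nbhd : NeighborhoodSeq n q a) where

  open Walks n q a public

  b : ℕ → ℕ
  b = bseq q

  a₂≡1 : a 2 ≡ 1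
  a₂≡1 = proj₁ nbhd

  a∈W-pred : ∀ {k} → 3 ≤ k → k ≤ n → InW q a (k ∸ 1) (a k)
  a∈W-pred 3≤k k≤n = proj₁ (proj₂ nbhd _ 3≤k k≤n)

  2≤q : ∀ {k} → 3 ≤ k → k ≤ n → 2 ≤ q k
  2≤q 3≤k k≤n = proj₁ (proj₂ (proj₂ nonLeaping) _ 3≤k k≤n)

  q-suc≤ : ∀ {k} → 2 ≤ k → suc k ≤ n → q (suc k) ≤ suc (q k)
  q-suc≤ {k} 2≤k k<n = subst (q (suc k) ≤_) (ℕ.+-comm (q k) 1) (proj₂ (proj₂ (proj₂ nonLeaping) _ (s≤s 2≤k) k<n))

  -- b₂ is defined to be 2, which agrees with the formula because q₂ = 1
  b≡ : ∀ {k} → 2 ≤ k → b k ≡ suc k ∸ q k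
  b≡ {suc zero} (s≤s ())
  b≡ {suc (suc zero)}    _ rewrite proj₁ (proj₂ nonLeaping) = refl
  b≡ {suc (suc (suc m))} _ = cong (_∸ q (3 ℕ.+ m)) (ℕ.+-comm (3 ℕ.+ m) 1)

  b-suc : ∀ {k} → 2 ≤ k → suc k ≤ n → b k ≤ b (suc k)
  b-suc {k} 2≤k k<n rewrite b≡ 2≤k | b≡ (ℕ.m≤n⇒m≤1+n 2≤k) = ℕ.∸-monoʳ-≤ (suc (suc k)) (q-suc≤ 2≤k k<n)

  b-mono : ∀ {i j} → 2 ≤ i → i ≤ j → j ≤ n → b i ≤ b j
  b-mono 2≤i i≤j j≤n with ℕ.m≤n⇒m<n∨m≡n i≤j
  ... | inj₂ refl = ≤-refl
  b-mono {j = suc j} 2≤i _ j<n | inj₁ (s≤s i≤j) = ≤-trans (b-mono 2≤i i≤j (<⇒≤ j<n)) (b-suc (≤-trans 2≤i i≤j) j<n)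

  2≤b : ∀ {k} → 2 ≤ k → k ≤ n → 2 ≤ b k
  2≤b 2≤k k≤n = b-mono ≤-refl 2≤k k≤n

  b<k : ∀ {k} → 3 ≤ k → k ≤ n → b k < k
  b<k {suc k} 3≤k k≤n rewrite b≡ (<⇒≤ 3≤k) = s≤s (ℕ.∸-monoʳ-≤ (suc (suc k)) (2≤q 3≤k k≤n))

  b≤k : ∀ {k} → 2 ≤ k → k ≤ n → b k ≤ k
  b≤k {suc zero} (s≤s ()) _
  b≤k {suc (suc zero)}    _ _   = ≤-refl
  b≤k {suc (suc (suc _))} _ k≤n = <⇒≤ (b<k (s≤s (s≤s (s≤s z≤n))) k≤n)

  a<b : ∀ {k} → 2 ≤ k → k ≤ n → a k < b k
  a<b {suc zero} (s≤s ()) _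
  a<b {suc (suc zero)}    _ _   rewrite a₂≡1 = ≤-refl
  a<b {suc (suc (suc _))} _ k≤n = proj₂ (proj₂ nbhd _ (s≤s (s≤s (s≤s z≤n))) k≤n)

  a∈W : ∀ {k} → 2 ≤ k → InW q a k (a k)
  a∈W {suc zero} (s≤s ())
  a∈W {suc (suc zero)}    _ = inj₁ (refl , a₂≡1)
  a∈W {suc (suc (suc _))} _ = inj₂ (s≤s (s≤s (s≤s z≤n)) , inj₁ refl)

  W-bounds : ∀ {k i} → k ≤ n → InW q a k i → 1 ≤ i × i < k
  W-bounds _ (inj₁ (refl , refl)) = ≤-refl , ≤-refl
  W-bounds {zero} _ (inj₂ (() , _))
  W-bounds {suc k} k<n (inj₂ (3≤k , inj₁ refl)) =
    proj₁ (W-bounds (<⇒≤ k<n) (a∈W-pred 3≤k k<n)) , <-trans (a<b (<⇒≤ 3≤k) k<n) (b<k 3≤k k<n)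
  W-bounds k≤n (inj₂ (3≤k , inj₂ (b≤i , i<k))) = ≤-trans (s≤s z≤n) (≤-trans (2≤b (<⇒≤ 3≤k) k≤n) b≤i) , i<k

  a-inRange : ∀ {k} → 2 ≤ k → k ≤ n → InRange n (a k)
  a-inRange 2≤k k≤n with W-bounds k≤n (a∈W 2≤k)
  ... | 1≤ak , ak<k = 1≤ak , ≤-trans (<⇒≤ ak<k) k≤n

  column-in-range : ∀ {j} → InRange n j → ColumnInRange n a j
  column-in-range {suc k} (1≤j , j<n) = (1≤j , j<n) , support
    where
    support : 3 ≤ suc k → InRange n (a (suc k)) × InRange n k × InRange n (a k)
    support (s≤s 2≤k) = a-inRange (ℕ.m≤n⇒m≤1+n 2≤k) j<n , (≤-trans (s≤s z≤n) 2≤k , <⇒≤ j<n) , a-inRange 2≤k (<⇒≤ j<n)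

  a-suc : ∀ {k} → 2 ≤ k → suc k ≤ n → a (suc k) ≡ a k ⊎ (3 ≤ k × b k ≤ a (suc k) × a (suc k) < k)
  a-suc 2≤k k<n with a∈W-pred (s≤s 2≤k) k<n
  ... | inj₁ (refl , a₃≡1)              = inj₁ (trans a₃≡1 (sym a₂≡1))
  ... | inj₂ (_ , inj₁ a-eq)            = inj₁ a-eq
  ... | inj₂ (3≤k , inj₂ (bk≤a , a<k)) = inj₂ (3≤k , bk≤a , a<k)

  a∈W-between : ∀ {k y} → 3 ≤ k → k ≤ n → b k ≤ y → y < k → InW q a y (a k)
  a∈W-between {suc k} {y} 3≤k k<n bk≤y (s≤s y≤k) with ℕ.m≤n⇒m<n∨m≡n y≤k | a∈W-pred 3≤k k<n
  ... | inj₂ refl | ak∈Wk = ak∈Wk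
  ... | inj₁ y<k  | inj₁ (refl , _) = contradiction (≤-trans (2≤b (s≤s (s≤s z≤n)) k<n) bk≤y) (ℕ.<⇒≱ y<k)
  ... | inj₁ y<k  | inj₂ (3≤k′ , inj₁ a-eq) rewrite a-eq =
    a∈W-between 3≤k′ (<⇒≤ k<n) (≤-trans (b-suc (<⇒≤ 3≤k′) k<n) bk≤y) y<k
  ... | inj₁ y<k  | inj₂ (3≤k′ , inj₂ (b≤ak , _)) =
    inj₂ (3≤y , inj₂ (≤-trans (b-mono (<⇒≤ 3≤y) (<⇒≤ y<k) (<⇒≤ k<n)) b≤ak , ak<y))
    where
    ak<y = <-≤-trans (a<b (<⇒≤ 3≤k) k<n) bk≤y
    3≤y  = ≤-<-trans (≤-trans (2≤b (<⇒≤ 3≤k′) (<⇒≤ k<n)) b≤ak) ak<y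

  W-clique : ∀ {k x y} → k ≤ n → InW q a k x → InW q a k y → x < y → InW q a y x
  W-clique _ (inj₁ (_ , refl)) (inj₁ (_ , refl)) (s≤s ())
  W-clique _ (inj₁ (refl , _)) (inj₂ (s≤s (s≤s ()) , _)) _
  W-clique _ (inj₂ (s≤s (s≤s ()) , _)) (inj₁ (refl , _)) _
  W-clique _ (inj₂ (_ , inj₁ refl)) (inj₂ (_ , inj₁ refl)) x<x = contradiction x<x (ℕ.<-irrefl refl)
  W-clique k≤n (inj₂ (3≤k , inj₁ refl)) (inj₂ (_ , inj₂ (bk≤y , y<k))) _ = a∈W-between 3≤k k≤n bk≤y y<k
  W-clique k≤n (inj₂ (3≤k , inj₂ (bk≤x , _))) (inj₂ (_ , inj₁ refl)) x<ak =
    contradiction (<-trans (<-≤-trans (a<b (<⇒≤ 3≤k) k≤n) bk≤x) x<ak) (ℕ.<-irrefl refl)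
  W-clique k≤n (inj₂ (3≤k , inj₂ (bk≤x , _))) (inj₂ (_ , inj₂ (_ , y<k))) x<y =
    inj₂ (3≤y , inj₂ (≤-trans (b-mono (<⇒≤ 3≤y) (<⇒≤ y<k) k≤n) bk≤x , x<y))
    where
    3≤y = ≤-<-trans (≤-trans (2≤b (<⇒≤ 3≤k) k≤n) bk≤x) x<y

  a-chain : ∀ {v w} → 3 ≤ v → v ≤ w → w ≤ n → a w < b v → a w ≡ a v
  a-chain 3≤v v≤w w≤n aw<bv with ℕ.m≤n⇒m<n∨m≡n v≤w
  ... | inj₂ refl = refl
  a-chain {v} {suc w} 3≤v _ w<n aw<bv | inj₁ (s≤s v≤w) with a∈W-pred (≤-trans 3≤v (ℕ.m≤n⇒m≤1+n v≤w)) w<n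
  ... | inj₁ (refl , _) = contradiction (≤-trans 3≤v v≤w) λ { (s≤s (s≤s ())) }
  ... | inj₂ (_ , inj₁ a-eq) = trans a-eq (a-chain 3≤v v≤w (<⇒≤ w<n) (subst (_< b v) a-eq aw<bv))
  ... | inj₂ (_ , inj₂ (bw≤aw , _)) =
    contradiction (≤-trans (b-mono (<⇒≤ 3≤v) v≤w (<⇒≤ w<n)) bw≤aw) (ℕ.<⇒≱ aw<bv)

  W⇒Adj : ∀ {k x} → k ≤ n → InW q a k x → Adj n q a x k
  W⇒Adj k≤n x∈Wk with W-bounds k≤n x∈Wk
  ... | 1≤x , x<k = (1≤x , ≤-trans (<⇒≤ x<k) k≤n) , (≤-trans 1≤x (<⇒≤ x<k) , k≤n) , inj₁ x∈Wk

  Adj⇒W : ∀ {w x} → Adj n q a w x → x < w → InW q a w x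
  Adj⇒W (_ , (_ , x≤n) , inj₁ w∈Wx) x<w = contradiction (proj₂ (W-bounds x≤n w∈Wx)) (ℕ.<-asym x<w)
  Adj⇒W (_ , _ , inj₂ x∈Ww) _ = x∈Ww

  -- an edge leaving {b_v, …} downwards either ends in a_v or comes from some w < v, whose
  -- neighbourhood W_w is a clique containing a_v
  exit-edge : ∀ {v w x} → 3 ≤ v → v ≤ n → b v ≤ w → Adj n q a w x → x < b v →
              x ≡ a v ⊎ (w < v × Adj n q a (a v) x)
  exit-edge {v} {w} {x} 3≤v v≤n bv≤w w~x x<bv with v ≤? w | Adj⇒W w~x (<-≤-trans x<bv bv≤w)
  ... | yes v≤w | inj₁ (refl , _) = contradiction (≤-trans 3≤v v≤w) λ { (s≤s (s≤s ())) }
  ... | yes v≤w | inj₂ (_ , inj₁ refl) = inj₁ (a-chain 3≤v v≤w (proj₂ (proj₁ w~x)) x<bv)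
  ... | yes v≤w | inj₂ (_ , inj₂ (bw≤x , _)) =
    contradiction (≤-trans (b-mono (<⇒≤ 3≤v) v≤w (proj₂ (proj₁ w~x))) bw≤x) (ℕ.<⇒≱ x<bv)
  ... | no v≰w | x∈Ww with ℕ.<-cmp x (a v)
  ...   | tri≈ _ x≡av _ = inj₁ x≡av
  ...   | tri< x<av _ _ = inj₂ (w<v , Adj-sym (W⇒Adj (proj₂ (a-inRange (<⇒≤ 3≤v) v≤n))
                                                     (W-clique w≤n x∈Ww av∈Ww x<av)))
    where
    w<v   = ℕ.≰⇒> v≰w
    w≤n   = proj₂ (proj₁ w~x)
    av∈Ww = a∈W-between 3≤v v≤n bv≤w w<v
  ...   | tri> _ _ av<x = inj₂ (w<v , W⇒Adj (proj₂ (proj₁ (proj₂ w~x))) (W-clique w≤n av∈Ww x∈Ww av<x))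
    where
    w<v   = ℕ.≰⇒> v≰w
    w≤n   = proj₂ (proj₁ w~x)
    av∈Ww = a∈W-between 3≤v v≤n bv≤w w<v

module Distances {n : ℕ} {q a : ℕ → ℕ} {D : ℕ → ℕ → ℕ}
  (nonLeaping : NonLeaping n q) (nbhd : NeighborhoodSeq n q a) (isDist : IsDistMatrix n q a D) where

  open Neighbourhood nonLeaping nbhd

  D-walk : ∀ {x y} → InRange n x → InRange n y → Walk n q a x y (D x y)
  D-walk (1≤x , x≤n) (1≤y , y≤n) = proj₁ (isDist _ _ 1≤x x≤n 1≤y y≤n)

  D-min : ∀ {x y m} → InRange n x → InRange n y → Walk n q a x y m → D x y ≤ m
  D-min (1≤x , x≤n) (1≤y , y≤n) walk = proj₂ (isDist _ _ 1≤x x≤n 1≤y y≤n) _ walk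

  D-refl : ∀ {x} → InRange n x → D x x ≡ 0
  D-refl x∈@(1≤x , x≤n) = ℕ.n≤0⇒n≡0 (D-min x∈ x∈ (nil 1≤x x≤n))

  D-sym : ∀ {x y} → InRange n x → InRange n y → D x y ≡ D y x
  D-sym x∈ y∈ = ℕ.≤-antisym (D-min x∈ y∈ (walk-reverse (D-walk y∈ x∈))) (D-min y∈ x∈ (walk-reverse (D-walk x∈ y∈)))

  D-pos : ∀ {x y} → InRange n x → InRange n y → x ≢ y → 1 ≤ D x y
  D-pos {x} {y} x∈ y∈ x≢y with D x y | D-walk x∈ y∈
  ... | zero  | walk = contradiction (walk₀⇒≡ walk) x≢y
  ... | suc _ | _    = s≤s z≤n

  D-adj : ∀ {x y} → Adj n q a x y → x ≢ y → D x y ≡ 1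
  D-adj x~y@(x∈ , y∈@(1≤y , y≤n) , _) x≢y = ℕ.≤-antisym (D-min x∈ y∈ (cons x~y (nil 1≤y y≤n))) (D-pos x∈ y∈ x≢y)

  D-step : ∀ {x y z} → Adj n q a x y → InRange n z → D x z ≤ suc (D y z)
  D-step x~y@(x∈ , y∈ , _) z∈ = D-min x∈ z∈ (cons x~y (D-walk y∈ z∈))

  W-D≡1ˡ : ∀ {k x} → k ≤ n → InW q a k x → D x k ≡ 1
  W-D≡1ˡ k≤n x∈Wk = D-adj (W⇒Adj k≤n x∈Wk) (ℕ.<⇒≢ (proj₂ (W-bounds k≤n x∈Wk)))

  W-D≡1ʳ : ∀ {k x} → k ≤ n → InW q a k x → D k x ≡ 1
  W-D≡1ʳ k≤n x∈Wk = D-adj (Adj-sym (W⇒Adj k≤n x∈Wk)) (ℕ.<⇒≢ (proj₂ (W-bounds k≤n x∈Wk)) ∘ sym)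

  D-a≤walk : ∀ {v u y m} → 3 ≤ v → v ≤ n → InRange n u → u < b v → b v ≤ y → Walk n q a y u m → D (a v) u ≤ m
  D-a≤walk 3≤v v≤n u∈ u<bv bv≤u (nil _ _) = contradiction bv≤u (ℕ.<⇒≱ u<bv)
  D-a≤walk {v} 3≤v v≤n u∈ u<bv bv≤y (cons {j = x} y~x walk) with b v ≤? x
  ... | yes bv≤x = ℕ.m≤n⇒m≤1+n (D-a≤walk 3≤v v≤n u∈ u<bv bv≤x walk)
  ... | no bv≰x with exit-edge 3≤v v≤n bv≤y y~x (ℕ.≰⇒> bv≰x)
  ...   | inj₁ refl       = ℕ.m≤n⇒m≤1+n (D-min (proj₁ (proj₂ y~x)) u∈ walk)
  ...   | inj₂ (_ , av~x) = ≤-trans (D-step av~x u∈) (s≤s (D-min (proj₁ (proj₂ y~x)) u∈ walk))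

  D-a<walk : ∀ {v u m} → 3 ≤ v → v ≤ n → InRange n u → u < b v → Walk n q a v u m → suc (D (a v) u) ≤ m
  D-a<walk 3≤v v≤n u∈ v<bv (nil _ _) = contradiction v<bv (ℕ.<-asym (b<k 3≤v v≤n))
  D-a<walk {v} 3≤v v≤n u∈ u<bv (cons {j = x} v~x walk) with b v ≤? x
  ... | yes bv≤x = s≤s (D-a≤walk 3≤v v≤n u∈ u<bv bv≤x walk)
  ... | no bv≰x with exit-edge 3≤v v≤n (<⇒≤ (b<k 3≤v v≤n)) v~x (ℕ.≰⇒> bv≰x)
  ...   | inj₁ refl     = s≤s (D-min (proj₁ (proj₂ v~x)) u∈ walk)
  ...   | inj₂ (v<v , _) = contradiction v<v (ℕ.<-irrefl refl)

  D-via-a : ∀ {v u} → 2 ≤ v → v ≤ n → InRange n u → u < b v → D v u ≡ suc (D (a v) u)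
  D-via-a {suc zero} (s≤s ()) _ _ _
  D-via-a {suc (suc zero)} {suc zero} _ 2≤n u∈ _ rewrite a₂≡1 | D-refl u∈ = W-D≡1ʳ 2≤n (inj₁ (refl , refl))
  D-via-a {suc (suc zero)} {suc (suc _)} _ _ _ (s≤s (s≤s ()))
  D-via-a {suc (suc (suc _))} 2≤v v≤n u∈ u<bv = ℕ.≤-antisym
    (D-step (Adj-sym (W⇒Adj v≤n (a∈W 2≤v))) u∈)
    (D-a<walk (s≤s (s≤s (s≤s z≤n))) v≤n u∈ u<bv (D-walk (s≤s z≤n , v≤n) u∈))

  D-a-difference : ∀ {k r} → 2 ≤ k → k ≤ n → 1 ≤ r → r ≤ k → + D r k - + D r (a k) ≡ [ r ≺ b k ] - [ r ≐ k ]
  D-a-difference {k} {r} 2≤k k≤n 1≤r r≤k with ℕ.m≤n⇒m<n∨m≡n r≤k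
  ... | inj₂ refl rewrite D-refl (1≤r , k≤n) | W-D≡1ʳ k≤n (a∈W 2≤k) | ≺-≥ (b≤k 2≤k k≤n) | ≐-≡ (refl {x = r}) = refl
  ... | inj₁ r<k with r <? b k
  ...   | yes r<bk rewrite ≺-< r<bk | ≐-≢ (ℕ.<⇒≢ r<k) | D-sym (1≤r , ≤-trans r≤k k≤n) (≤-trans 1≤r r≤k , k≤n)
                         | D-via-a 2≤k k≤n (1≤r , ≤-trans r≤k k≤n) r<bk
                         | D-sym (a-inRange 2≤k k≤n) (1≤r , ≤-trans r≤k k≤n) = 1+x-x≡1 (+ D r (a k))
    where
    1+x-x≡1 : ∀ x → (+ 1 + x) - x ≡ + 1
    1+x-x≡1 = solve-∀
  ...   | no r≮bk = interior (ℕ.≮⇒≥ r≮bk) (≤-<-trans (≤-trans (2≤b 2≤k k≤n) (ℕ.≮⇒≥ r≮bk)) r<k)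
    where
    interior : b k ≤ r → 3 ≤ k → + D r k - + D r (a k) ≡ [ r ≺ b k ] - [ r ≐ k ]
    interior bk≤r 3≤k rewrite ≺-≥ bk≤r | ≐-≢ (ℕ.<⇒≢ r<k) | W-D≡1ˡ k≤n (inj₂ (3≤k , inj₂ (bk≤r , r<k)))
                        | W-D≡1ʳ (≤-trans r≤k k≤n) (a∈W-between 3≤k k≤n bk≤r r<k) = refl

  DE : ℕ → ℕ → ℤ
  DE r j = rowE a (λ s → + D r s) j

  DE-formula : ∀ {k r} → 2 ≤ k → suc k ≤ n → 1 ≤ r → r ≤ k →
               DE r (suc k) ≡ ([ r ≺ b (suc k) ] - [ r ≺ b k ]) + [ r ≐ k ]
  DE-formula {k} {r} 2≤k k<n 1≤r r≤k = begin
      DE r (suc k)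
    ≡⟨ rowE-large a (λ s → + D r s) (s≤s 2≤k) ⟩
      ((+ D r (suc k) - + D r (a (suc k))) - + D r k) + + D r (a k)
    ≡⟨ regroup (+ D r (suc k)) (+ D r (a (suc k))) (+ D r k) (+ D r (a k)) ⟩
      (+ D r (suc k) - + D r (a (suc k))) - (+ D r k - + D r (a k))
    ≡⟨ cong₂ _-_ (D-a-difference (ℕ.m≤n⇒m≤1+n 2≤k) k<n 1≤r (ℕ.m≤n⇒m≤1+n r≤k))
                 (D-a-difference 2≤k (<⇒≤ k<n) 1≤r r≤k) ⟩
      ([ r ≺ b (suc k) ] - [ r ≐ suc k ]) - ([ r ≺ b k ] - [ r ≐ k ])
    ≡⟨ cong (λ z → ([ r ≺ b (suc k) ] - z) - ([ r ≺ b k ] - [ r ≐ k ])) (≐-≢ (ℕ.<⇒≢ (s≤s r≤k))) ⟩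
      ([ r ≺ b (suc k) ] - + 0) - ([ r ≺ b k ] - [ r ≐ k ])
    ≡⟨ regroup′ [ r ≺ b (suc k) ] [ r ≺ b k ] [ r ≐ k ] ⟩
      ([ r ≺ b (suc k) ] - [ r ≺ b k ]) + [ r ≐ k ]
    ∎
    where
    open ≡-Reasoning
    regroup : ∀ w x y z → ((w - x) - y) + z ≡ (w - x) - (y - z)
    regroup = solve-∀
    regroup′ : ∀ x y z → (x - + 0) - (y - z) ≡ (x - y) + z
    regroup′ = solve-∀

  DE-vanishes : ∀ {k r} → 2 ≤ k → suc k ≤ n → 1 ≤ r → r < b k → DE r (suc k) ≡ + 0
  DE-vanishes {k} {r} 2≤k k<n 1≤r r<bk = vanish (<-≤-trans r<bk (b≤k 2≤k (<⇒≤ k<n)))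
    where
    vanish : r < k → DE r (suc k) ≡ + 0
    vanish r<k rewrite DE-formula 2≤k k<n 1≤r (<⇒≤ r<k) | ≺-< (<-≤-trans r<bk (b-suc 2≤k k<n)) | ≺-< r<bk
                     | ≐-≢ (ℕ.<⇒≢ r<k) = refl

  EᵀDE : ℕ → ℕ → ℤ
  EᵀDE i j = rowE a (λ r → DE r j) i

  EᵀDE-sym : ∀ {i j} → InRange n i → InRange n j → EᵀDE i j ≡ EᵀDE j i
  EᵀDE-sym {i} {j} i∈ j∈ = trans (rowE-swap a (λ r s → + D r s) i j)
    (rowE-cong {a = a} (column-in-range j∈) λ s s∈ →
      rowE-cong {a = a} (column-in-range i∈) λ r r∈ → cong +_ (D-sym r∈ s∈))

  EᵀDE-low : ∀ {i k} → 1 ≤ i → i ≤ 2 → 2 ≤ k → suc k ≤ n → EᵀDE i (suc k) ≡ Aupper q i (suc k)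
  EᵀDE-low {i} {k} 1≤i i≤2 2≤k k<n = begin
      EᵀDE i (suc k)
    ≡⟨ rowE-small a (λ r → DE r (suc k)) (s≤s i≤2) ⟩
      DE i (suc k)
    ≡⟨ DE-formula 2≤k k<n 1≤i (≤-trans i≤2 2≤k) ⟩
      ([ i ≺ b (suc k) ] - [ i ≺ b k ]) + [ i ≐ k ]
    ≡⟨ cong₂ (λ x y → (x - y) + [ i ≐ k ]) (≺-≤ (≤-trans i≤2 (2≤b (ℕ.m≤n⇒m≤1+n 2≤k) k<n)))
                                          (≺-≤ (≤-trans i≤2 (2≤b 2≤k (<⇒≤ k<n)))) ⟩
      ((+ 1 - [ i ≐ b (suc k) ]) - (+ 1 - [ i ≐ b k ])) + [ i ≐ k ]
    ≡⟨ cancel [ i ≐ b (suc k) ] [ i ≐ b k ] [ i ≐ k ] ⟩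
      ([ i ≐ b k ] - [ i ≐ b (suc k) ]) + [ i ≐ k ]
    ≡⟨ Aupper-large q i (s≤s 2≤k) ⟨
      Aupper q i (suc k)
    ∎
    where
    open ≡-Reasoning
    cancel : ∀ x y z → ((+ 1 - x) - (+ 1 - y)) + z ≡ (y - x) + z
    cancel = solve-∀

  EᵀDE-mid : ∀ {p k} → 2 ≤ p → p < k → suc k ≤ n → EᵀDE (suc p) (suc k) ≡ Aupper q (suc p) (suc k)
  EᵀDE-mid {p} {k} 2≤p p<k k<n = begin
      EᵀDE (suc p) (suc k)
    ≡⟨ rowE-large a (λ r → DE r (suc k)) (s≤s 2≤p) ⟩
      ((DE (suc p) (suc k) - DE (a (suc p)) (suc k)) - DE p (suc k)) + DE (a p) (suc k)
    ≡⟨ cong₂ (λ x y → ((DE (suc p) (suc k) - x) - DE p (suc k)) + y)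
             (DE-vanishes 2≤k k<n (proj₁ (a-inRange 2≤1+p 1+p≤n)) (<-≤-trans (a<b 2≤1+p 1+p≤n) (b-mono 2≤1+p p<k k≤n)))
             (DE-vanishes 2≤k k<n (proj₁ (a-inRange 2≤p p≤n)) (<-≤-trans (a<b 2≤p p≤n) (b-mono 2≤p (<⇒≤ p<k) k≤n))) ⟩
      ((DE (suc p) (suc k) - + 0) - DE p (suc k)) + + 0
    ≡⟨ cong₂ (λ x y → ((x - + 0) - y) + + 0) (DE-formula 2≤k k<n (s≤s z≤n) p<k)
                                              (DE-formula 2≤k k<n (≤-trans (s≤s z≤n) 2≤p) (<⇒≤ p<k)) ⟩
      (((([ suc p ≺ B ] - [ suc p ≺ b k ]) + [ suc p ≐ k ]) - + 0) - (([ p ≺ B ] - [ p ≺ b k ]) + [ p ≐ k ])) + + 0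
    ≡⟨ cong (λ z → (((([ suc p ≺ B ] - [ suc p ≺ b k ]) + [ suc p ≐ k ]) - + 0) - (([ p ≺ B ] - [ p ≺ b k ]) + z)) + + 0)
            (≐-≢ (ℕ.<⇒≢ p<k)) ⟩
      (((([ suc p ≺ B ] - [ suc p ≺ b k ]) + [ suc p ≐ k ]) - + 0) - (([ p ≺ B ] - [ p ≺ b k ]) + + 0)) + + 0
    ≡⟨ regroup [ suc p ≺ B ] [ p ≺ B ] [ suc p ≺ b k ] [ p ≺ b k ] [ suc p ≐ k ] ⟩
      (([ suc p ≺ B ] - [ p ≺ B ]) - ([ suc p ≺ b k ] - [ p ≺ b k ])) + [ suc p ≐ k ]
    ≡⟨ cong₂ (λ x y → (x - y) + [ suc p ≐ k ]) (≺-suc p B) (≺-suc p (b k)) ⟩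
      (- [ suc p ≐ B ] - - [ suc p ≐ b k ]) + [ suc p ≐ k ]
    ≡⟨ regroup′ [ suc p ≐ B ] [ suc p ≐ b k ] [ suc p ≐ k ] ⟩
      ([ suc p ≐ b k ] - [ suc p ≐ B ]) + [ suc p ≐ k ]
    ≡⟨ Aupper-large q (suc p) (s≤s 2≤k) ⟨
      Aupper q (suc p) (suc k)
    ∎
    where
    open ≡-Reasoning
    B = b (suc k)
    k≤n = <⇒≤ k<n
    2≤k = ≤-trans 2≤p (<⇒≤ p<k)
    2≤1+p = ℕ.m≤n⇒m≤1+n 2≤p
    1+p≤n = ≤-trans p<k k≤n
    p≤n = <⇒≤ 1+p≤n
    regroup : ∀ x₁ x₀ y₁ y₀ z → ((((x₁ - y₁) + z) - + 0) - ((x₀ - y₀) + + 0)) + + 0 ≡ ((x₁ - x₀) - (y₁ - y₀)) + z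
    regroup = solve-∀
    regroup′ : ∀ x y z → (- x - - y) + z ≡ (y - x) + z
    regroup′ = solve-∀

  D-a-suc-a+≺≡1 : ∀ {k} → 2 ≤ k → suc k ≤ n → + D (a (suc k)) (a k) + [ a (suc k) ≺ b k ] ≡ + 1
  D-a-suc-a+≺≡1 {k} 2≤k k<n with a-suc 2≤k k<n
  ... | inj₁ a-eq rewrite a-eq | D-refl (a-inRange 2≤k (<⇒≤ k<n)) | ≺-< (a<b 2≤k (<⇒≤ k<n)) = refl
  ... | inj₂ (3≤k , bk≤a , a<k)
    rewrite ≺-≥ bk≤a | W-D≡1ʳ (≤-trans (<⇒≤ a<k) (<⇒≤ k<n)) (a∈W-between 3≤k (<⇒≤ k<n) bk≤a a<k) = refl

  EᵀDE-diag : ∀ {k} → 2 ≤ k → suc k ≤ n → EᵀDE (suc k) (suc k) ≡ - + 2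
  EᵀDE-diag {k} 2≤k k<n = begin
      EᵀDE j j
    ≡⟨ rowE-large a (λ r → DE r j) 3≤j ⟩
      ((DE j j - DE (a j) j) - DE k j) + DE (a k) j
    ≡⟨ cong₂ _+_ (cong₂ _-_ (cong₂ _-_ DE-jj DE-aj) DE-k) (DE-vanishes 2≤k k<n (proj₁ ak∈) (a<b 2≤k k≤n)) ⟩
      (((((+ 0 - + 1) - + 1) + (+ 1 + + X)) - ((+ 1 - L) + + 0)) - ((+ 0 - + 0) + + 1)) + + 0
    ≡⟨ collect (+ X) L ⟩
      (+ X + L) - + 3
    ≡⟨ cong (λ z → z - + 3) (D-a-suc-a+≺≡1 2≤k k<n) ⟩
      - + 2
    ∎
    where
    open ≡-Reasoning
    j = suc k
    X = D (a j) (a k)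
    L = [ a j ≺ b k ]
    3≤j : 3 ≤ j
    3≤j = s≤s 2≤k
    2≤j = ℕ.m≤n⇒m≤1+n 2≤k
    k≤n = <⇒≤ k<n
    ak∈ = a-inRange 2≤k k≤n
    aj<k = proj₂ (W-bounds k≤n (a∈W-pred 3≤j k<n))
    DE-jj : DE j j ≡ ((+ 0 - + 1) - + 1) + (+ 1 + + X)
    DE-jj = trans (rowE-large a (λ s → + D j s) 3≤j)
      (cong₂ _+_ (cong₂ _-_ (cong₂ _-_ (cong +_ (D-refl (s≤s z≤n , k<n))) (cong +_ (W-D≡1ʳ k<n (a∈W 2≤j))))
                            (cong +_ (W-D≡1ʳ k<n (inj₂ (3≤j , inj₂ (ℕ.≤-pred (b<k 3≤j k<n) , ≤-refl))))))
                 (cong +_ (D-via-a 2≤j k<n ak∈ (<-≤-trans (a<b 2≤k k≤n) (b-suc 2≤k k<n)))))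
    DE-aj : DE (a j) j ≡ (+ 1 - L) + + 0
    DE-aj = trans (DE-formula 2≤k k<n (proj₁ (a-inRange 2≤j k<n)) (<⇒≤ aj<k))
      (cong₂ _+_ (cong (_- L) (≺-< (a<b 2≤j k<n))) (≐-≢ (ℕ.<⇒≢ aj<k)))
    DE-k : DE k j ≡ (+ 0 - + 0) + + 1
    DE-k = trans (DE-formula 2≤k k<n (≤-trans (s≤s z≤n) 2≤k) ≤-refl)
      (cong₂ _+_ (cong₂ _-_ (≺-≥ (ℕ.≤-pred (b<k 3≤j k<n))) (≺-≥ (b≤k 2≤k k≤n))) (≐-≡ refl))
    collect : ∀ x l → (((((+ 0 - + 1) - + 1) + (+ 1 + x)) - ((+ 1 - l) + + 0)) - ((+ 0 - + 0) + + 1)) + + 0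
                      ≡ (x + l) - + 3
    collect = solve-∀

  EᵀDE-upper : ∀ i j → 1 ≤ i → i ≤ j → j ≤ n → EᵀDE i j ≡ Amat q i j
  EᵀDE-upper 1 1 _ _ 1≤n = cong +_ (D-refl (≤-refl , 1≤n))
  EᵀDE-upper 1 2 _ _ 2≤n = cong +_ (W-D≡1ˡ 2≤n (inj₁ (refl , refl)))
  EᵀDE-upper 2 2 _ _ 2≤n = cong +_ (D-refl (s≤s z≤n , 2≤n))
  EᵀDE-upper 1 j@(suc (suc (suc _))) 1≤i _ j≤n =
    trans (EᵀDE-low 1≤i (s≤s z≤n) (s≤s (s≤s z≤n)) j≤n) (sym (Amat-< q {1} {j} (s≤s (s≤s z≤n))))
  EᵀDE-upper 2 j@(suc (suc (suc _))) 1≤i _ j≤n =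
    trans (EᵀDE-low 1≤i ≤-refl (s≤s (s≤s z≤n)) j≤n) (sym (Amat-< q {2} {j} (s≤s (s≤s (s≤s z≤n)))))
  EᵀDE-upper (suc p@(suc (suc _))) (suc k@(suc (suc _))) _ i≤j j≤n with p ≟ k
  ... | yes refl = trans (EᵀDE-diag (s≤s (s≤s z≤n)) j≤n) (sym (Amat-diag q {suc k} (s≤s (s≤s (s≤s z≤n)))))
  ... | no p≢k   = trans (EᵀDE-mid (s≤s (s≤s z≤n)) p<k j≤n) (sym (Amat-< q {suc p} (s≤s p<k)))
    where p<k = ℕ.≤∧≢⇒< (ℕ.≤-pred i≤j) p≢k
  EᵀDE-upper 0 _ () _ _
  EᵀDE-upper (suc _) 0 _ () _
  EᵀDE-upper 2 1 _ (s≤s ()) _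
  EᵀDE-upper (suc (suc (suc _))) 1 _ (s≤s ()) _
  EᵀDE-upper (suc (suc (suc _))) 2 _ (s≤s (s≤s ())) _

  EᵀDE≡Amat : ∀ {i j} → InRange n i → InRange n j → EᵀDE i j ≡ Amat q i j
  EᵀDE≡Amat {i} {j} (1≤i , i≤n) (1≤j , j≤n) with i ≤? j
  ... | yes i≤j = EᵀDE-upper i j 1≤i i≤j j≤n
  ... | no i≰j  = trans (EᵀDE-sym (1≤i , i≤n) (1≤j , j≤n))
                 (trans (EᵀDE-upper j i 1≤j (<⇒≤ (ℕ.≰⇒> i≰j)) i≤n) (Amat-sym q j i))

theorem2p13 : (n : ℕ) (q a : ℕ → ℕ) (D : ℕ → ℕ → ℕ) →
    2 ≤ n → NonLeaping n q → NeighborhoodSeq n q a → IsDistMatrix n q a D →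
    ∀ i j → 1 ≤ i → i ≤ n → 1 ≤ j → j ≤ n → EtDE n a D i j ≡ Amat q i j
theorem2p13 n q a D _ nonLeaping nbhd isDist i j 1≤i i≤n 1≤j j≤n = begin
    EtDE n a D i j
  ≡⟨ EtDE≡rowE² n a D (column-in-range (1≤i , i≤n)) (column-in-range (1≤j , j≤n)) ⟩
    EᵀDE i j
  ≡⟨ EᵀDE≡Amat (1≤i , i≤n) (1≤j , j≤n) ⟩
    Amat q i j
  ∎
  where
  open ≡-Reasoning
  open Neighbourhood nonLeaping nbhd
  open Distances nonLeaping nbhd isDist
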